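{- For nonnegative integers $A,B,C$ with $A$ even and $B\ge 2$, with $D[\cdot,\cdot,\cdot]$ as defined in the context, $$D[A,B,C] = D[A+2,B-2,C] + D[A,B-2,C].$$
   Context: Let $n\ge 1$. A partial 2-max function is a function $f$ from a subset $S\subseteq\{1,\dots,n\}$ to $\{1,\dots,n\}$ such that every value has at most two preimages. Its parameters are: $A$ = the number of elements $i\in S$ whose image $f(i)$ has exactly two preimages under $f$ (so $A$ is even); $B$ = the number of elements $i\in S$ whose image has exactly one preimage; $C=n-A-B$ = the number of elements of $\{1,\dots,n\}$ on which $f$ is undefined. An $f$-derangement is a permutation $g$ of $\{1,\dots,n\}$ with $g(i)\neq f(i)$ for every $i\in S$. The number of $f$-derangements depends only on $(A,B,C)$, and is denoted $D[A,B,C]$, where $n=A+B+C$ (so $D[A,B-2,C]$ refers to permutations of $n-2$ elements). -}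

module Defs where

open import Data.Nat using (ℕ; zero; suc; _≤_; _≟_)
open import Data.Fin using (Fin)
open import Data.Fin.Properties using (all?) renaming (_≟_ to _≟F_)
open import Data.Maybe using (Maybe; just; nothing)
open import Data.Maybe.Properties using (≡-dec)
open import Data.List using (List; []; _∷_; [_]; map; concatMap; filter; length; allFin)
open import Data.Vec using (Vec; lookup) renaming ([] to []ᵛ; _∷_ to _∷ᵛ_)
open import Relation.Binary.PropositionalEquality using (_≡_; _≢_)
open import Relation.Nullary using (Dec; ¬?)
open import Relation.Nullary.Decidable using (_→-dec_; _×-dec_)
open import Data.Product using (_×_)

-- A partial function from {1..n} to {1..n}: undefined points map to nothing.
PFun : ℕ → Set
PFun n = Fin n → Maybe (Fin n)

preimages : ∀ {n} → PFun n → Fin n → ℕ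
preimages {n} f y = length (filter (λ i → ≡-dec _≟F_ (f i) (just y)) (allFin n))

IsPartial2Max : ∀ {n} → PFun n → Set
IsPartial2Max {n} f = ∀ (y : Fin n) → preimages f y ≤ 2

imageMult : ∀ {n} → PFun n → Fin n → ℕ
imageMult f i with f i
... | nothing = 0
... | just y  = preimages f y

paramA : ∀ {n} → PFun n → ℕ
paramA {n} f = length (filter (λ i → imageMult f i ≟ 2) (allFin n))

paramB : ∀ {n} → PFun n → ℕ
paramB {n} f = length (filter (λ i → imageMult f i ≟ 1) (allFin n))

paramC : ∀ {n} → PFun n → ℕ
paramC {n} f = length (filter (λ i → ≡-dec _≟F_ (f i) nothing) (allFin n))

allVecs : ∀ {n} (k : ℕ) → List (Vec (Fin n) k)
allVecs zero = [ []ᵛ ]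
allVecs {n} (suc k) = concatMap (λ x → map (x ∷ᵛ_) (allVecs k)) (allFin n)

-- g (given by its table of values) is a permutation of {1..n}
-- (an injective self-map of a finite set)
IsPerm : ∀ {n} → Vec (Fin n) n → Set
IsPerm {n} g = ∀ (i j : Fin n) → lookup g i ≡ lookup g j → i ≡ j

isPerm? : ∀ {n} (g : Vec (Fin n) n) → Dec (IsPerm g)
isPerm? g = all? (λ i → all? (λ j → (lookup g i ≟F lookup g j) →-dec (i ≟F j)))

IsFDerangement : ∀ {n} → PFun n → Vec (Fin n) n → Set
IsFDerangement {n} f g = IsPerm g × (∀ (i : Fin n) → f i ≢ just (lookup g i))

isFDerangement? : ∀ {n} (f : PFun n) (g : Vec (Fin n) n) → Dec (IsFDerangement f g)
isFDerangement? f g =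
  isPerm? g ×-dec all? (λ i → ¬? (≡-dec _≟F_ (f i) (just (lookup g i))))

numDerangements : ∀ {n} → PFun n → ℕ
numDerangements {n} f = length (filter (isFDerangement? f) (allVecs n))

HasParams : ∀ {n} → PFun n → ℕ → ℕ → ℕ → Set
HasParams f A B C =
  IsPartial2Max f × (paramA f ≡ A) × (paramB f ≡ B) × (paramC f ≡ C)

-- An f-derangement is an injective assignment of values to the positions 1..n in which
-- position i avoids the value f i. Count such assignments more generally for any list of
-- constraints and any set of still available values. Dropping the constraint "not y" at one
-- position (y available) adds exactly the assignments sending that position to y, i.e. the
-- assignments of the remaining positions with y used up (deletion-contraction). Applying this at
-- a value forbidden once or twice lowers the number p₁ or p₂ of available values forbidden exactly
-- once or twice, so by induction on (p₂, p₁) the count depends only on the number of positions,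
-- the number of available values, p₁ and p₂, provided no value is forbidden more than twice.
-- For f these are n, n, B and A/2 (A counts each doubly hit value twice). Deletion-contraction
-- at a value hit once by f, at a value hit twice by f₁, and again at a value hit once in the
-- contraction from f produces states whose counts agree by this invariance, and the recurrence
-- is the resulting linear relation.

module Submission where

open import Defs
open import Data.Bool using (Bool; true; false; _∧_; not; if_then_else_; T)
open import Data.Bool.Properties using (T-≡)
open import Data.Empty using (⊥-elim)
open import Data.Fin using (Fin; zero; suc; punchIn)
open import Data.Fin.Properties using (punchInᵢ≢i; 0≢1+n) renaming (_≟_ to _≟F_)
import Data.Fin.Properties as Finₚ
open import Data.List using (List; []; _∷_; _++_; length; map; filter; concatMap; tabulate; allFin)
open import Data.List.Properties using (length-++-sucʳ; length-tabulate; map-++; map-∘; map-cong)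
open import Data.Maybe using (Maybe; just; nothing; maybe′)
open import Data.Maybe.Properties using (≡-dec)
open import Data.Nat using (ℕ; zero; suc; pred; _+_; _*_; _∸_; _≤_; _≡ᵇ_; s≤s)
open import Data.Nat.Divisibility using (_∣_; divides)
open import Data.Nat.ListAction using () renaming (sum to sumᴸ)
open import Data.Nat.ListAction.Properties using () renaming (sum-++ to sumᴸ-++)
open import Data.Nat.Properties
  using (+-*-semiring; +-commutativeSemigroup; *-commutativeSemigroup; +-comm; +-assoc; +-identityʳ;
         +-suc; *-comm; *-zeroʳ; *-distribˡ-+; +-cancelʳ-≡; *-cancelʳ-≡; m+n≡0⇒m≡0; m+n≡0⇒n≡0;
         m≤n+m; ≤-trans; suc-injective; ≡ᵇ⇒≡)
  renaming (_≟_ to _≟ℕ_)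
open import Data.Product using (_×_; _,_; ∃₂; ∃-syntax)
open import Data.Vec using (Vec; lookup) renaming ([] to []ᵛ; _∷_ to _∷ᵛ_)
open import Data.Vec.Functional using (removeAt)
open import Function using (_∘_)
open import Function.Bundles using (Equivalence; _⇔_; mk⇔)
open import Level using (0ℓ)
open import Relation.Binary.PropositionalEquality
  using (_≡_; _≢_; refl; sym; trans; cong; cong₂; subst; subst₂; module ≡-Reasoning)
open import Relation.Nullary using (Dec; does; yes; no)
open import Relation.Nullary.Decidable using (dec-true; dec-false; does-⇔; T?)
open import Relation.Unary using (Pred; Decidable)

open import Algebra.Properties.Semiring.Sum +-*-semiring
  using (sum; sum-remove; sum-cong-≗; sum-replicate-zero; ∑-comm; *-distribˡ-sum; *-distribʳ-sum)
open import Algebra.Properties.CommutativeSemigroup +-commutativeSemigroup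
  using () renaming (x∙yz≈y∙xz to +-left-comm)
open import Algebra.Properties.CommutativeSemigroup *-commutativeSemigroup
  using () renaming (x∙yz≈y∙xz to *-left-comm)
open ≡-Reasoning

-- Indicator sums

⟦_⟧ : Bool → ℕ
⟦ true ⟧ = 1
⟦ false ⟧ = 0

false≢true : false ≢ true
false≢true ()

⟦⟧≡0 : ∀ {b} → ⟦ b ⟧ ≡ 0 → b ≡ false
⟦⟧≡0 {false} _ = refl

⟦∧⟧ : ∀ a b → ⟦ a ∧ b ⟧ ≡ ⟦ a ⟧ * ⟦ b ⟧
⟦∧⟧ true  b = sym (+-identityʳ ⟦ b ⟧)
⟦∧⟧ false b = refl

∧-true : ∀ {a b} → a ∧ b ≡ true → a ≡ true × b ≡ true
∧-true {true} b≡true = refl , b≡true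

scale-indicator : ∀ m j → m * ⟦ m ≡ᵇ j ⟧ ≡ j * ⟦ m ≡ᵇ j ⟧
scale-indicator m j with m ≡ᵇ j in m≡ᵇj
... | true  = cong (_* 1) (≡ᵇ⇒≡ m j (Equivalence.from T-≡ m≡ᵇj))
... | false = trans (*-zeroʳ m) (sym (*-zeroʳ j))

sum-update : ∀ {n} (y : Fin n) {g h : Fin n → ℕ} → (∀ z → z ≢ y → g z ≡ h z) →
  sum g + h y ≡ sum h + g y
sum-update {suc n} y {g} {h} g≡h = begin
  sum g + h y                        ≡⟨ cong (_+ h y) (sum-remove {i = y} g) ⟩
  g y + sum (removeAt g y) + h y     ≡⟨ cong (λ s → g y + s + h y) rest ⟩
  g y + sum (removeAt h y) + h y     ≡⟨ swap-ends (g y) _ (h y) ⟩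
  h y + sum (removeAt h y) + g y     ≡⟨ cong (_+ g y) (sym (sum-remove {i = y} h)) ⟩
  sum h + g y                        ∎
  where
  rest : sum (removeAt g y) ≡ sum (removeAt h y)
  rest = sum-cong-≗ (λ z → g≡h (punchIn y z) (punchInᵢ≢i y z))
  swap-ends : ∀ a b c → a + b + c ≡ c + b + a
  swap-ends a b c = trans (+-comm (a + b) c) (trans (cong (c +_) (+-comm a b)) (sym (+-assoc c b a)))

indicator-witness : ∀ {n} (b : Fin n → Bool) {p} → sum (λ i → ⟦ b i ⟧) ≡ suc p → ∃[ i ] b i ≡ true
indicator-witness {suc n} b e with b zero in b₀
... | true  = zero , b₀
... | false with indicator-witness (b ∘ suc) e
...   | i , bᵢ = suc i , bᵢ

length-filter≡sum : ∀ {A : Set} {P : Pred A 0ℓ} (P? : Decidable P) xs →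
  length (filter P? xs) ≡ sumᴸ (map (λ x → ⟦ does (P? x) ⟧) xs)
length-filter≡sum P? []       = refl
length-filter≡sum P? (x ∷ xs) with does (P? x)
... | true  = cong suc (length-filter≡sum P? xs)
... | false = length-filter≡sum P? xs

sumᴸ-tabulate : ∀ {A : Set} {n} (h : Fin n → A) (g : A → ℕ) → sumᴸ (map g (tabulate h)) ≡ sum (g ∘ h)
sumᴸ-tabulate {n = zero}  h g = refl
sumᴸ-tabulate {n = suc n} h g = cong (g (h zero) +_) (sumᴸ-tabulate (h ∘ suc) g)

sumᴸ-allFin : ∀ {n} (g : Fin n → ℕ) → sumᴸ (map g (allFin n)) ≡ sum g
sumᴸ-allFin g = sumᴸ-tabulate (λ i → i) g

length-filter-allFin : ∀ {n} {P : Pred (Fin n) 0ℓ} (P? : Decidable P) →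
  length (filter P? (allFin n)) ≡ sum (λ i → ⟦ does (P? i) ⟧)
length-filter-allFin {n} P? = trans (length-filter≡sum P? (allFin n)) (sumᴸ-allFin (λ i → ⟦ does (P? i) ⟧))

sumᴸ-concatMap : ∀ {A B : Set} (h : B → ℕ) (F : A → List B) xs →
  sumᴸ (map h (concatMap F xs)) ≡ sumᴸ (map (λ x → sumᴸ (map h (F x))) xs)
sumᴸ-concatMap h F []       = refl
sumᴸ-concatMap h F (x ∷ xs) = begin
  sumᴸ (map h (F x ++ concatMap F xs))              ≡⟨ cong sumᴸ (map-++ h (F x) _) ⟩
  sumᴸ (map h (F x) ++ map h (concatMap F xs))      ≡⟨ sumᴸ-++ (map h (F x)) _ ⟩
  sumᴸ (map h (F x)) + sumᴸ (map h (concatMap F xs)) ≡⟨ cong (sumᴸ (map h (F x)) +_) (sumᴸ-concatMap h F xs) ⟩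
  sumᴸ (map (λ x → sumᴸ (map h (F x))) (x ∷ xs))    ∎

sumᴸ-*ˡ : ∀ {A : Set} c (g : A → ℕ) xs → sumᴸ (map (λ x → c * g x) xs) ≡ c * sumᴸ (map g xs)
sumᴸ-*ˡ c g []       = sym (*-zeroʳ c)
sumᴸ-*ˡ c g (x ∷ xs) = trans (cong (c * g x +_) (sumᴸ-*ˡ c g xs)) (sym (*-distribˡ-+ c (g x) _))

-- Arrangements avoiding forbidden values

Avail : ℕ → Set
Avail n = Fin n → Bool

remove : ∀ {n} → Avail n → Fin n → Avail n
remove av x z = if does (z ≟F x) then false else av z

size : ∀ {n} → Avail n → ℕ
size av = sum (λ z → ⟦ av z ⟧)

remove-self : ∀ {n} (av : Avail n) x → remove av x x ≡ false
remove-self av x rewrite dec-true (x ≟F x) refl = refl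

remove-other : ∀ {n} (av : Avail n) {x z} → z ≢ x → remove av x z ≡ av z
remove-other av {x} {z} z≢x rewrite dec-false (z ≟F x) z≢x = refl

remove-available : ∀ {n} (av : Avail n) x {z} → remove av x z ≡ true → av z ≡ true
remove-available av x {z} e with does (z ≟F x)
... | false = e

remove-comm : ∀ {n} (av : Avail n) x y z → remove (remove av x) y z ≡ remove (remove av y) x z
remove-comm av x y z with does (z ≟F x) | does (z ≟F y)
... | true  | true  = refl
... | true  | false = refl
... | false | true  = refl
... | false | false = refl

remove-cong : ∀ {n} {av av′ : Avail n} → (∀ z → av z ≡ av′ z) → ∀ x z → remove av x z ≡ remove av′ x z
remove-cong av≗av′ x z with does (z ≟F x)
... | true  = refl
... | false = av≗av′ z

size-remove : ∀ {n} {av : Avail n} {y} → av y ≡ true → size (remove av y) ≡ pred (size av)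
size-remove {av = av} {y} avy = cong pred (begin
  suc (size (remove av y))           ≡⟨ +-comm 1 _ ⟩
  size (remove av y) + ⟦ true ⟧      ≡⟨ cong (λ b → size (remove av y) + ⟦ b ⟧) (sym avy) ⟩
  size (remove av y) + ⟦ av y ⟧      ≡⟨ sum-update y (λ z z≢y → cong ⟦_⟧ (remove-other av z≢y)) ⟩
  size av + ⟦ remove av y y ⟧        ≡⟨ cong (λ b → size av + ⟦ b ⟧) (remove-self av y) ⟩
  size av + 0                        ≡⟨ +-identityʳ _ ⟩
  size av                            ∎)

Constraints : ℕ → Set
Constraints n = List (Maybe (Fin n))

hits : ∀ {n} → Maybe (Fin n) → Fin n → Bool
hits c y = does (≡-dec _≟F_ c (just y))

allowed : ∀ {n} → Avail n → Maybe (Fin n) → Fin n → Bool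
allowed av c x = av x ∧ not (hits c x)

hits-self : ∀ {n} (x : Fin n) → hits (just x) x ≡ true
hits-self x = dec-true (x ≟F x) refl

-- Each entry of cs is a position with its forbidden value (nothing: no constraint); this counts the
-- injective maps from the positions to available values that avoid every forbidden value.
arrangements : ∀ {n} → Constraints n → Avail n → ℕ
arrangements []       av = 1
arrangements (c ∷ cs) av = sum (λ x → ⟦ allowed av c x ⟧ * arrangements cs (remove av x))

arrangements-cong : ∀ {n} (cs : Constraints n) {av av′ : Avail n} → (∀ z → av z ≡ av′ z) →
  arrangements cs av ≡ arrangements cs av′
arrangements-cong []       av≗av′ = refl
arrangements-cong (c ∷ cs) av≗av′ = sum-cong-≗ λ x →
  cong₂ (λ a t → ⟦ a ∧ not (hits c x) ⟧ * t) (av≗av′ x) (arrangements-cong cs (remove-cong av≗av′ x))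

arrangements-swap : ∀ {n} (c d : Maybe (Fin n)) cs (av : Avail n) →
  arrangements (c ∷ d ∷ cs) av ≡ arrangements (d ∷ c ∷ cs) av
arrangements-swap c d cs av = begin
  sum (λ x → ⟦ allowed av c x ⟧ * sum (λ y → term x y))
    ≡⟨ sum-cong-≗ (λ x → *-distribˡ-sum ⟦ allowed av c x ⟧ (term x)) ⟩
  sum (λ x → sum (λ y → ⟦ allowed av c x ⟧ * term x y))
    ≡⟨ ∑-comm (λ x y → ⟦ allowed av c x ⟧ * term x y) ⟩
  sum (λ y → sum (λ x → ⟦ allowed av c x ⟧ * term x y))
    ≡⟨ sum-cong-≗ (λ y → sum-cong-≗ (λ x → summand-swap x y)) ⟩
  sum (λ y → sum (λ x → ⟦ allowed av d y ⟧ * term′ y x))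
    ≡⟨ sum-cong-≗ (λ y → sym (*-distribˡ-sum ⟦ allowed av d y ⟧ (term′ y))) ⟩
  sum (λ y → ⟦ allowed av d y ⟧ * sum (λ x → term′ y x))   ∎
  where
  term : Fin _ → Fin _ → ℕ
  term x y = ⟦ allowed (remove av x) d y ⟧ * arrangements cs (remove (remove av x) y)
  term′ : Fin _ → Fin _ → ℕ
  term′ y x = ⟦ allowed (remove av y) c x ⟧ * arrangements cs (remove (remove av y) x)
  summand-swap : ∀ x y → ⟦ allowed av c x ⟧ * term x y ≡ ⟦ allowed av d y ⟧ * term′ y x
  summand-swap x y = by-cases (y ≟F x)
    where
    by-cases : Dec (y ≡ x) → ⟦ allowed av c x ⟧ * term x y ≡ ⟦ allowed av d y ⟧ * term′ y x
    by-cases (yes refl) rewrite remove-self av y =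
      trans (*-zeroʳ ⟦ allowed av c y ⟧) (sym (*-zeroʳ ⟦ allowed av d y ⟧))
    by-cases (no y≢x) rewrite remove-other av y≢x | remove-other av (y≢x ∘ sym)
                            | arrangements-cong cs (remove-comm av x y) =
      *-left-comm ⟦ allowed av c x ⟧ ⟦ allowed av d y ⟧ _

arrangements-to-front : ∀ {n} (L : Constraints n) c R (av : Avail n) →
  arrangements (L ++ c ∷ R) av ≡ arrangements (c ∷ L ++ R) av
arrangements-to-front []      c R av = refl
arrangements-to-front (d ∷ L) c R av = begin
  sum (λ x → ⟦ allowed av d x ⟧ * arrangements (L ++ c ∷ R) (remove av x))
    ≡⟨ sum-cong-≗ (λ x → cong (⟦ allowed av d x ⟧ *_) (arrangements-to-front L c R (remove av x))) ⟩
  arrangements (d ∷ c ∷ L ++ R) av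
    ≡⟨ arrangements-swap d c (L ++ R) av ⟩
  arrangements (c ∷ d ∷ L ++ R) av   ∎

deletion-contraction-head : ∀ {n} {y : Fin n} cs {av : Avail n} → av y ≡ true →
  arrangements (just y ∷ cs) av + arrangements cs (remove av y) ≡ arrangements (nothing ∷ cs) av
deletion-contraction-head {y = y} cs {av} avy = begin
  sum g + rest y  ≡⟨ cong (sum g +_) h-y ⟨
  sum g + h y     ≡⟨ sum-update y agree ⟩
  sum h + g y     ≡⟨ cong (sum h +_) g-y ⟩
  sum h + 0       ≡⟨ +-identityʳ (sum h) ⟩
  sum h           ∎
  where
  rest g h : Fin _ → ℕ
  rest x = arrangements cs (remove av x)
  g x = ⟦ allowed av (just y) x ⟧ * rest x
  h x = ⟦ allowed av nothing x ⟧ * rest x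
  g-y : g y ≡ 0
  g-y rewrite avy | hits-self y = refl
  h-y : h y ≡ rest y
  h-y rewrite avy = +-identityʳ (rest y)
  agree : ∀ z → z ≢ y → g z ≡ h z
  agree z z≢y rewrite dec-false (y ≟F z) (z≢y ∘ sym) = refl

multiplicity : ∀ {n} → Constraints n → Fin n → ℕ
multiplicity []       y = 0
multiplicity (c ∷ cs) y = ⟦ hits c y ⟧ + multiplicity cs y

multiplicity-middle : ∀ {n} (L : Constraints n) c R y →
  multiplicity (L ++ c ∷ R) y ≡ ⟦ hits c y ⟧ + multiplicity (L ++ R) y
multiplicity-middle []      c R y = refl
multiplicity-middle (d ∷ L) c R y =
  trans (cong (⟦ hits d y ⟧ +_) (multiplicity-middle L c R y)) (+-left-comm ⟦ hits d y ⟧ ⟦ hits c y ⟧ _)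

split-at-occurrence : ∀ {n} (cs : Constraints n) y {j} → multiplicity cs y ≡ suc j →
  ∃₂ λ L R → cs ≡ L ++ just y ∷ R
split-at-occurrence (nothing ∷ cs) y e with split-at-occurrence cs y e
... | L , R , refl = nothing ∷ L , R , refl
split-at-occurrence (just z ∷ cs) y e with z ≟F y
... | yes refl = [] , cs , refl
... | no _ with split-at-occurrence cs y e
...   | L , R , refl = just z ∷ L , R , refl

forbiddenExactly : ∀ {n} → ℕ → Constraints n → Avail n → ℕ
forbiddenExactly i cs av = sum (λ z → ⟦ av z ∧ (multiplicity cs z ≡ᵇ i) ⟧)

AtMostTwice : ∀ {n} → Constraints n → Avail n → Set
AtMostTwice cs av = ∀ z → av z ≡ true → multiplicity cs z ≤ 2

forbiddenExactly-witness : ∀ {n} i (cs : Constraints n) (av : Avail n) {p} →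
  forbiddenExactly i cs av ≡ suc p → ∃[ y ] av y ≡ true × multiplicity cs y ≡ i
forbiddenExactly-witness i cs av e with indicator-witness _ e
... | y , hit with av y in avy
...   | true = y , avy , ≡ᵇ⇒≡ _ i (Equivalence.from T-≡ hit)

forbiddenExactly-remove : ∀ {n} i (cs cs′ : Constraints n) (av : Avail n) {y} → av y ≡ true →
  (∀ z → z ≢ y → multiplicity cs z ≡ multiplicity cs′ z) →
  forbiddenExactly i cs av ≡ forbiddenExactly i cs′ (remove av y) + ⟦ multiplicity cs y ≡ᵇ i ⟧
forbiddenExactly-remove i cs cs′ av {y} avy agree = begin
  forbiddenExactly i cs av                                ≡⟨ +-identityʳ _ ⟨
  forbiddenExactly i cs av + 0                            ≡⟨ cong (forbiddenExactly i cs av +_) removed-y ⟨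
  forbiddenExactly i cs av + at cs′ (remove av y) y       ≡⟨ sum-update y agree′ ⟩
  forbiddenExactly i cs′ (remove av y) + at cs av y       ≡⟨ cong (forbiddenExactly i cs′ (remove av y) +_) at-y ⟩
  forbiddenExactly i cs′ (remove av y) + ⟦ multiplicity cs y ≡ᵇ i ⟧   ∎
  where
  at : Constraints _ → Avail _ → Fin _ → ℕ
  at cs av z = ⟦ av z ∧ (multiplicity cs z ≡ᵇ i) ⟧
  removed-y : at cs′ (remove av y) y ≡ 0
  removed-y rewrite remove-self av y = refl
  at-y : at cs av y ≡ ⟦ multiplicity cs y ≡ᵇ i ⟧
  at-y rewrite avy = refl
  agree′ : ∀ z → z ≢ y → at cs av z ≡ at cs′ (remove av y) z
  agree′ z z≢y rewrite remove-other av z≢y | agree z z≢y = refl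

unforbidden : ∀ {n} {cs : Constraints n} {av : Avail n} → AtMostTwice cs av →
  forbiddenExactly 1 cs av ≡ 0 → forbiddenExactly 2 cs av ≡ 0 →
  ∀ y → av y ≡ true → multiplicity cs y ≡ 0
unforbidden {cs = cs} {av} bounded once≡0 twice≡0 y avy
  with multiplicity cs y | absent 1 once≡0 | absent 2 twice≡0 | bounded y avy
  where
  absent : ∀ i → forbiddenExactly i cs av ≡ 0 → ⟦ multiplicity cs y ≡ᵇ i ⟧ ≡ 0
  absent i e = m+n≡0⇒n≡0 _ (trans (sym (forbiddenExactly-remove i cs cs av avy (λ _ _ → refl))) e)
... | 0                 | _  | _  | _ = refl
... | 1                 | () | _  | _
... | 2                 | _  | () | _
... | suc (suc (suc _)) | _  | _  | s≤s (s≤s ())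

fallingFactorial : ℕ → ℕ → ℕ
fallingFactorial m zero    = 1
fallingFactorial m (suc k) = m * fallingFactorial (pred m) k

arrangements-unconstrained : ∀ {n} (cs : Constraints n) {av : Avail n} →
  (∀ y → av y ≡ true → multiplicity cs y ≡ 0) →
  arrangements cs av ≡ fallingFactorial (size av) (length cs)
arrangements-unconstrained []       _    = refl
arrangements-unconstrained (c ∷ cs) {av} free = begin
  sum (λ x → ⟦ allowed av c x ⟧ * arrangements cs (remove av x))  ≡⟨ sum-cong-≗ summand ⟩
  sum (λ x → ⟦ av x ⟧ * F)                                        ≡⟨ *-distribʳ-sum F (λ x → ⟦ av x ⟧) ⟨
  size av * F                                                     ∎
  where
  F : ℕ
  F = fallingFactorial (pred (size av)) (length cs)
  summand : ∀ x → ⟦ allowed av c x ⟧ * arrangements cs (remove av x) ≡ ⟦ av x ⟧ * F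
  summand x with av x in avx
  ... | false = refl
  ... | true = begin
    ⟦ not (hits c x) ⟧ * arrangements cs (remove av x)
      ≡⟨ cong (λ b → ⟦ not b ⟧ * arrangements cs (remove av x)) (⟦⟧≡0 (m+n≡0⇒m≡0 ⟦ hits c x ⟧ (free x avx))) ⟩
    arrangements cs (remove av x) + 0
      ≡⟨ cong (_+ 0) (arrangements-unconstrained cs free-after-x) ⟩
    fallingFactorial (size (remove av x)) (length cs) + 0
      ≡⟨ cong (λ s → fallingFactorial s (length cs) + 0) (size-remove {av = av} avx) ⟩
    F + 0 ∎
    where
    free-after-x : ∀ z → remove av x z ≡ true → multiplicity cs z ≡ 0
    free-after-x z avz = m+n≡0⇒n≡0 ⟦ hits c z ⟧ (free z (remove-available av x avz))

-- The number of arrangements depends only on the shape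

record Relaxation {n} (cs : Constraints n) (av : Avail n) (y : Fin n) (j : ℕ) : Set where
  field
    relaxed contracted   : Constraints n
    deletion-contraction : arrangements cs av + arrangements contracted (remove av y) ≡ arrangements relaxed av
    length-relaxed       : length relaxed ≡ length cs
    length-contracted    : length contracted ≡ pred (length cs)
    relaxed-≤            : ∀ z → multiplicity relaxed z ≤ multiplicity cs z
    contracted-≤         : ∀ z → multiplicity contracted z ≤ multiplicity cs z
    exactly              : ∀ i → forbiddenExactly i cs av
                                 ≡ forbiddenExactly i contracted (remove av y) + ⟦ suc j ≡ᵇ i ⟧
    exactly-relaxed      : ∀ i → forbiddenExactly i relaxed av
                                 ≡ forbiddenExactly i contracted (remove av y) + ⟦ j ≡ᵇ i ⟧

relaxation : ∀ {n} {cs : Constraints n} {av : Avail n} {y j} → av y ≡ true → multiplicity cs y ≡ suc j →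
  Relaxation cs av y j
relaxation {cs = cs} {av} {y} {j} avy μy with split-at-occurrence cs y μy
... | L , R , refl = record
  { relaxed              = L ++ nothing ∷ R
  ; contracted           = L ++ R
  ; deletion-contraction = begin
      arrangements (L ++ just y ∷ R) av + arrangements (L ++ R) (remove av y)
        ≡⟨ cong (_+ arrangements (L ++ R) (remove av y)) (arrangements-to-front L (just y) R av) ⟩
      arrangements (just y ∷ L ++ R) av + arrangements (L ++ R) (remove av y)
        ≡⟨ deletion-contraction-head (L ++ R) avy ⟩
      arrangements (nothing ∷ L ++ R) av
        ≡⟨ arrangements-to-front L nothing R av ⟨
      arrangements (L ++ nothing ∷ R) av ∎
  ; length-relaxed       = trans (length-++-sucʳ L nothing R) (sym (length-++-sucʳ L (just y) R))
  ; length-contracted    = cong pred (sym (length-++-sucʳ L (just y) R))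
  ; relaxed-≤            = λ z → subst₂ _≤_ (sym (multiplicity-middle L nothing R z))
                                          (sym (multiplicity-middle L (just y) R z)) (m≤n+m _ _)
  ; contracted-≤         = λ z → subst (_ ≤_) (sym (multiplicity-middle L (just y) R z)) (m≤n+m _ _)
  ; exactly              = λ i → trans (forbiddenExactly-remove i (L ++ just y ∷ R) (L ++ R) av avy elsewhere)
                                         (cong (contracted-plus i) μy)
  ; exactly-relaxed      = λ i → trans (forbiddenExactly-remove i (L ++ nothing ∷ R) (L ++ R) av avy
                                           (λ z _ → multiplicity-middle L nothing R z))
                                         (cong (contracted-plus i) relaxed-μy)
  }
  where
  contracted-plus : ℕ → ℕ → ℕ
  contracted-plus i μ = forbiddenExactly i (L ++ R) (remove av y) + ⟦ μ ≡ᵇ i ⟧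
  elsewhere : ∀ z → z ≢ y → multiplicity (L ++ just y ∷ R) z ≡ multiplicity (L ++ R) z
  elsewhere z z≢y = trans (multiplicity-middle L (just y) R z)
    (cong (λ b → ⟦ b ⟧ + multiplicity (L ++ R) z) (dec-false (y ≟F z) (z≢y ∘ sym)))
  relaxed-μy : multiplicity (L ++ nothing ∷ R) y ≡ j
  relaxed-μy = suc-injective (begin
    suc (multiplicity (L ++ nothing ∷ R) y)       ≡⟨ cong suc (multiplicity-middle L nothing R y) ⟩
    ⟦ true ⟧ + multiplicity (L ++ R) y            ≡⟨ cong (λ b → ⟦ b ⟧ + multiplicity (L ++ R) y) (hits-self y) ⟨
    ⟦ hits (just y) y ⟧ + multiplicity (L ++ R) y ≡⟨ multiplicity-middle L (just y) R y ⟨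
    multiplicity (L ++ just y ∷ R) y              ≡⟨ μy ⟩
    suc j                                         ∎)

record Shape {n} (cs : Constraints n) (av : Avail n) (k m p₁ p₂ : ℕ) : Set where
  field
    atMostTwice : AtMostTwice cs av
    positions   : length cs ≡ k
    available   : size av ≡ m
    once        : forbiddenExactly 1 cs av ≡ p₁
    twice       : forbiddenExactly 2 cs av ≡ p₂

record Reduction {n} (cs : Constraints n) (av : Avail n) (k m r₁ r₂ c₁ c₂ : ℕ) : Set where
  field
    relaxed contracted   : Constraints n
    contractedAvail      : Avail n
    relaxed-shape        : Shape relaxed av k m r₁ r₂
    contracted-shape     : Shape contracted contractedAvail (pred k) (pred m) c₁ c₂
    deletion-contraction : arrangements cs av + arrangements contracted contractedAvail ≡ arrangements relaxed av

reduction : ∀ {n} {cs : Constraints n} {av : Avail n} {y j k m p₁ p₂ r₁ r₂ c₁ c₂} →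
  av y ≡ true → Shape cs av k m p₁ p₂ → (R : Relaxation cs av y j) →
  let open Relaxation R in
  forbiddenExactly 1 relaxed av ≡ r₁ → forbiddenExactly 2 relaxed av ≡ r₂ →
  forbiddenExactly 1 contracted (remove av y) ≡ c₁ → forbiddenExactly 2 contracted (remove av y) ≡ c₂ →
  Reduction cs av k m r₁ r₂ c₁ c₂
reduction {av = av} {y} avy s R r₁ r₂ c₁ c₂ = record
  { relaxed              = relaxed
  ; contracted           = contracted
  ; contractedAvail      = remove av y
  ; relaxed-shape        = record
    { atMostTwice = λ z avz → ≤-trans (relaxed-≤ z) (atMostTwice z avz)
    ; positions   = trans length-relaxed positions
    ; available   = available
    ; once        = r₁
    ; twice       = r₂
    }
  ; contracted-shape     = record
    { atMostTwice = λ z avz → ≤-trans (contracted-≤ z) (atMostTwice z (remove-available av y avz))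
    ; positions   = trans length-contracted (cong pred positions)
    ; available   = trans (size-remove {av = av} avy) (cong pred available)
    ; once        = c₁
    ; twice       = c₂
    }
  ; deletion-contraction = deletion-contraction
  }
  where
  open Relaxation R
  open Shape s

reduce-single : ∀ {n} {cs : Constraints n} {av : Avail n} {k m p₁ p₂} →
  Shape cs av k m (suc p₁) p₂ → Reduction cs av k m p₁ p₂ p₁ p₂
reduce-single {cs = cs} {av} {p₁ = p₁} {p₂} s with forbiddenExactly-witness 1 cs av (Shape.once s)
... | y , avy , μy = reduction avy s R
  (trans (exactly-relaxed 1) (trans (+-identityʳ _) contracted-once))
  (trans (exactly-relaxed 2) (trans (+-identityʳ _) contracted-twice))
  contracted-once contracted-twice
  where
  R : Relaxation cs av y 0
  R = relaxation avy μy
  open Relaxation R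
  contracted-once : forbiddenExactly 1 contracted (remove av y) ≡ p₁
  contracted-once = suc-injective (trans (+-comm 1 _) (trans (sym (exactly 1)) (Shape.once s)))
  contracted-twice : forbiddenExactly 2 contracted (remove av y) ≡ p₂
  contracted-twice = trans (sym (+-identityʳ _)) (trans (sym (exactly 2)) (Shape.twice s))

reduce-double : ∀ {n} {cs : Constraints n} {av : Avail n} {k m p₁ p₂} →
  Shape cs av k m p₁ (suc p₂) → Reduction cs av k m (suc p₁) p₂ p₁ p₂
reduce-double {cs = cs} {av} {p₁ = p₁} {p₂} s with forbiddenExactly-witness 2 cs av (Shape.twice s)
... | y , avy , μy = reduction avy s R
  (trans (exactly-relaxed 1) (trans (+-comm _ 1) (cong suc contracted-once)))
  (trans (exactly-relaxed 2) (trans (+-identityʳ _) contracted-twice))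
  contracted-once contracted-twice
  where
  R : Relaxation cs av y 1
  R = relaxation avy μy
  open Relaxation R
  contracted-once : forbiddenExactly 1 contracted (remove av y) ≡ p₁
  contracted-once = trans (sym (+-identityʳ _)) (trans (sym (exactly 1)) (Shape.once s))
  contracted-twice : forbiddenExactly 2 contracted (remove av y) ≡ p₂
  contracted-twice = suc-injective (trans (+-comm 1 _) (trans (sym (exactly 2)) (Shape.twice s)))

arrangements≡fallingFactorial : ∀ {n} {cs : Constraints n} {av : Avail n} {k m} →
  Shape cs av k m 0 0 → arrangements cs av ≡ fallingFactorial m k
arrangements≡fallingFactorial {cs = cs} {av} s =
  trans (arrangements-unconstrained cs (unforbidden {cs = cs} {av} atMostTwice once twice))
  (cong₂ fallingFactorial available positions)
  where open Shape s

ShapeDetermines : (k m p₁ p₂ : ℕ) → Set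
ShapeDetermines k m p₁ p₂ = ∀ {n n′} {cs : Constraints n} {cs′ : Constraints n′} {av av′} →
  Shape cs av k m p₁ p₂ → Shape cs′ av′ k m p₁ p₂ → arrangements cs av ≡ arrangements cs′ av′

reductions-agree : ∀ {n n′} {cs : Constraints n} {cs′ : Constraints n′} {av av′} {k m r₁ r₂ c₁ c₂} →
  Reduction cs av k m r₁ r₂ c₁ c₂ → Reduction cs′ av′ k m r₁ r₂ c₁ c₂ →
  ShapeDetermines k m r₁ r₂ → ShapeDetermines (pred k) (pred m) c₁ c₂ →
  arrangements cs av ≡ arrangements cs′ av′
reductions-agree {cs = cs} {cs′} {av} {av′} ρ ρ′ relaxed≡ contracted≡ = +-cancelʳ-≡ _ _ _ (begin
  arrangements cs av + arrangements (contracted ρ) (contractedAvail ρ)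
    ≡⟨ deletion-contraction ρ ⟩
  arrangements (relaxed ρ) av
    ≡⟨ relaxed≡ (relaxed-shape ρ) (relaxed-shape ρ′) ⟩
  arrangements (relaxed ρ′) av′
    ≡⟨ deletion-contraction ρ′ ⟨
  arrangements cs′ av′ + arrangements (contracted ρ′) (contractedAvail ρ′)
    ≡⟨ cong (arrangements cs′ av′ +_) (contracted≡ (contracted-shape ρ) (contracted-shape ρ′)) ⟨
  arrangements cs′ av′ + arrangements (contracted ρ) (contractedAvail ρ)   ∎)
  where open Reduction

arrangements-determined : ∀ p₂ p₁ {k m} → ShapeDetermines k m p₁ p₂
arrangements-determined zero     zero     s s′ =
  trans (arrangements≡fallingFactorial s) (sym (arrangements≡fallingFactorial s′))
arrangements-determined p₂       (suc p₁) s s′ = reductions-agree (reduce-single s) (reduce-single s′)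
  (arrangements-determined p₂ p₁) (arrangements-determined p₂ p₁)
arrangements-determined (suc p₂) zero     s s′ = reductions-agree (reduce-double s) (reduce-double s′)
  (arrangements-determined p₂ 1) (arrangements-determined p₂ 0)

-- Derangements of a partial function as arrangements

isArrangement : ∀ {n k} → (Fin k → Maybe (Fin n)) → Avail n → Vec (Fin n) k → Bool
isArrangement cs av []ᵛ       = true
isArrangement cs av (x ∷ᵛ xs) = allowed av (cs zero) x ∧ isArrangement (cs ∘ suc) (remove av x) xs

arrangements-tabulate : ∀ {n} k (cs : Fin k → Maybe (Fin n)) (av : Avail n) →
  sumᴸ (map (λ v → ⟦ isArrangement cs av v ⟧) (allVecs k)) ≡ arrangements (tabulate cs) av
arrangements-tabulate zero    cs av = refl
arrangements-tabulate {n} (suc k) cs av = begin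
  sumᴸ (map h (concatMap (λ x → map (x ∷ᵛ_) (allVecs k)) (allFin n)))
    ≡⟨ sumᴸ-concatMap h (λ x → map (x ∷ᵛ_) (allVecs k)) (allFin n) ⟩
  sumᴸ (map (λ x → sumᴸ (map h (map (x ∷ᵛ_) (allVecs k)))) (allFin n))
    ≡⟨ sumᴸ-allFin (λ x → sumᴸ (map h (map (x ∷ᵛ_) (allVecs k)))) ⟩
  sum (λ x → sumᴸ (map h (map (x ∷ᵛ_) (allVecs k))))
    ≡⟨ sum-cong-≗ first-value ⟩
  arrangements (tabulate cs) av   ∎
  where
  h : Vec (Fin n) (suc k) → ℕ
  h v = ⟦ isArrangement cs av v ⟧
  first-value : ∀ x → sumᴸ (map h (map (x ∷ᵛ_) (allVecs k)))
                      ≡ ⟦ allowed av (cs zero) x ⟧ * arrangements (tabulate (cs ∘ suc)) (remove av x)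
  first-value x = begin
    sumᴸ (map h (map (x ∷ᵛ_) (allVecs k)))      ≡⟨ cong sumᴸ (map-∘ (allVecs k)) ⟨
    sumᴸ (map (h ∘ (x ∷ᵛ_)) (allVecs k))        ≡⟨ cong sumᴸ (map-cong (λ v → ⟦∧⟧ first (rest v)) (allVecs k)) ⟩
    sumᴸ (map (λ v → ⟦ first ⟧ * ⟦ rest v ⟧) (allVecs k))
                                                ≡⟨ sumᴸ-*ˡ ⟦ first ⟧ (λ v → ⟦ rest v ⟧) (allVecs k) ⟩
    ⟦ first ⟧ * sumᴸ (map (λ v → ⟦ rest v ⟧) (allVecs k))
                                                ≡⟨ cong (⟦ first ⟧ *_) (arrangements-tabulate k (cs ∘ suc) (remove av x)) ⟩
    ⟦ first ⟧ * arrangements (tabulate (cs ∘ suc)) (remove av x)   ∎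
    where
    first : Bool
    first = allowed av (cs zero) x
    rest : Vec (Fin n) k → Bool
    rest = isArrangement (cs ∘ suc) (remove av x)

allowed-sound : ∀ {n} {av : Avail n} c {x} → allowed av c x ≡ true → av x ≡ true × c ≢ just x
allowed-sound {av = av} c {x} ok with ∧-true {av x} ok
... | avx , unhit = avx , λ { refl → false≢true (trans (cong not (sym (hits-self x))) unhit) }

allowed-complete : ∀ {n} {av : Avail n} c {x} → av x ≡ true → c ≢ just x → allowed av c x ≡ true
allowed-complete {av = av} c {x} avx c≢x
  rewrite avx | dec-false (≡-dec _≟F_ c (just x)) c≢x = refl

IsArrangement : ∀ {n k} → (Fin k → Maybe (Fin n)) → Avail n → Vec (Fin n) k → Set
IsArrangement cs av v = (∀ i j → lookup v i ≡ lookup v j → i ≡ j)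
                      × (∀ i → av (lookup v i) ≡ true)
                      × (∀ i → cs i ≢ just (lookup v i))

isArrangement-sound : ∀ {n k} (cs : Fin k → Maybe (Fin n)) av v →
  isArrangement cs av v ≡ true → IsArrangement cs av v
isArrangement-sound cs av []ᵛ       _  = (λ ()) , (λ ()) , (λ ())
isArrangement-sound cs av (x ∷ᵛ v) ok with ∧-true {allowed av (cs zero) x} ok
... | head-ok , tail-ok
  with allowed-sound {av = av} (cs zero) head-ok | isArrangement-sound (cs ∘ suc) (remove av x) v tail-ok
...   | avx , cs₀≢x | injective , available , avoids = injective′ , available′ , avoids′
  where
  x∉v : ∀ i → x ≢ lookup v i
  x∉v i refl = false≢true (trans (sym (remove-self av x)) (available i))
  injective′ : ∀ i j → lookup (x ∷ᵛ v) i ≡ lookup (x ∷ᵛ v) j → i ≡ j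
  injective′ zero    zero    _ = refl
  injective′ zero    (suc j) e = ⊥-elim (x∉v j e)
  injective′ (suc i) zero    e = ⊥-elim (x∉v i (sym e))
  injective′ (suc i) (suc j) e = cong suc (injective i j e)
  available′ : ∀ i → av (lookup (x ∷ᵛ v) i) ≡ true
  available′ zero    = avx
  available′ (suc i) = remove-available av x (available i)
  avoids′ : ∀ i → cs i ≢ just (lookup (x ∷ᵛ v) i)
  avoids′ zero    = cs₀≢x
  avoids′ (suc i) = avoids i

isArrangement-complete : ∀ {n k} (cs : Fin k → Maybe (Fin n)) av v →
  IsArrangement cs av v → isArrangement cs av v ≡ true
isArrangement-complete cs av []ᵛ       _ = refl
isArrangement-complete cs av (x ∷ᵛ v) (injective , available , avoids)
  rewrite allowed-complete {av = av} (cs zero) (available zero) (avoids zero) =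
  isArrangement-complete (cs ∘ suc) (remove av x) v
    ( (λ i j e → Finₚ.suc-injective (injective (suc i) (suc j) e))
    , (λ i → trans (remove-other av (0≢1+n ∘ injective zero (suc i) ∘ sym)) (available (suc i)))
    , (λ i → avoids (suc i)) )

allAvailable : ∀ {n} → Avail n
allAvailable _ = true

size-allAvailable : ∀ n → size {n} allAvailable ≡ n
size-allAvailable zero    = refl
size-allAvailable (suc n) = cong suc (size-allAvailable n)

numDerangements≡arrangements : ∀ {n} (f : PFun n) → numDerangements f ≡ arrangements (tabulate f) allAvailable
numDerangements≡arrangements {n} f = begin
  length (filter (isFDerangement? f) (allVecs n))
    ≡⟨ length-filter≡sum (isFDerangement? f) (allVecs n) ⟩
  sumᴸ (map (λ v → ⟦ does (isFDerangement? f v) ⟧) (allVecs n))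
    ≡⟨ cong sumᴸ (map-cong (λ v → cong ⟦_⟧ (does≡ v)) (allVecs n)) ⟩
  sumᴸ (map (λ v → ⟦ isArrangement f allAvailable v ⟧) (allVecs n))
    ≡⟨ arrangements-tabulate n f allAvailable ⟩
  arrangements (tabulate f) allAvailable   ∎
  where
  derangement⇔ : ∀ v → IsFDerangement f v ⇔ T (isArrangement f allAvailable v)
  derangement⇔ v = mk⇔
    (λ (perm , avoids) →
      Equivalence.from T-≡ (isArrangement-complete f allAvailable v (perm , (λ _ → refl) , avoids)))
    (λ ok → let perm , _ , avoids = isArrangement-sound f allAvailable v (Equivalence.to T-≡ ok)
            in perm , avoids)
  does≡ : ∀ v → does (isFDerangement? f v) ≡ isArrangement f allAvailable v
  does≡ v = does-⇔ (derangement⇔ v) (isFDerangement? f v) (T? _)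

multiplicity-tabulate : ∀ {n k} (h : Fin k → Maybe (Fin n)) y →
  multiplicity (tabulate h) y ≡ sum (λ i → ⟦ hits (h i) y ⟧)
multiplicity-tabulate {k = zero}  h y = refl
multiplicity-tabulate {k = suc k} h y = cong (⟦ hits (h zero) y ⟧ +_) (multiplicity-tabulate (h ∘ suc) y)

preimages≡multiplicity : ∀ {n} (f : PFun n) y → preimages f y ≡ multiplicity (tabulate f) y
preimages≡multiplicity f y =
  trans (length-filter-allFin (λ i → ≡-dec _≟F_ (f i) (just y))) (sym (multiplicity-tabulate f y))

sum-hits : ∀ {n} (c : Maybe (Fin n)) (g : Fin n → ℕ) → sum (λ y → ⟦ hits c y ⟧ * g y) ≡ maybe′ g 0 c
sum-hits {n} nothing  g = sum-replicate-zero n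
sum-hits {n} (just z) g = begin
  sum (λ y → ⟦ hits (just z) y ⟧ * g y)
    ≡⟨ +-identityʳ _ ⟨
  sum (λ y → ⟦ hits (just z) y ⟧ * g y) + 0
    ≡⟨ sum-update z {h = λ _ → 0} (λ y y≢z → cong (λ b → ⟦ b ⟧ * g y) (dec-false (z ≟F y) (y≢z ∘ sym))) ⟩
  sum {n} (λ _ → 0) + ⟦ hits (just z) z ⟧ * g z
    ≡⟨ cong₂ (λ s b → s + ⟦ b ⟧ * g z) (sum-replicate-zero n) (hits-self z) ⟩
  g z + 0
    ≡⟨ +-identityʳ (g z) ⟩
  g z ∎

-- Double counting: each value with exactly j preimages contributes its j preimages.
imageMult-count : ∀ {n} (f : PFun n) j →
  length (filter (λ i → imageMult f i ≟ℕ suc j) (allFin n))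
    ≡ suc j * forbiddenExactly (suc j) (tabulate f) allAvailable
imageMult-count {n} f j = begin
  length (filter (λ i → imageMult f i ≟ℕ suc j) (allFin n))
    ≡⟨ length-filter-allFin (λ i → imageMult f i ≟ℕ suc j) ⟩
  sum (λ i → ⟦ imageMult f i ≡ᵇ suc j ⟧)
    ≡⟨ sum-cong-≗ image-indicator ⟩
  sum (λ i → maybe′ g 0 (f i))
    ≡⟨ sum-cong-≗ (λ i → sym (sum-hits (f i) g)) ⟩
  sum (λ i → sum (λ y → ⟦ hits (f i) y ⟧ * g y))
    ≡⟨ ∑-comm (λ i y → ⟦ hits (f i) y ⟧ * g y) ⟩
  sum (λ y → sum (λ i → ⟦ hits (f i) y ⟧ * g y))
    ≡⟨ sum-cong-≗ (λ y → sym (*-distribʳ-sum (g y) (λ i → ⟦ hits (f i) y ⟧))) ⟩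
  sum (λ y → sum (λ i → ⟦ hits (f i) y ⟧) * g y)
    ≡⟨ sum-cong-≗ (λ y → cong (_* g y) (length-filter-allFin (λ i → ≡-dec _≟F_ (f i) (just y)))) ⟨
  sum (λ y → preimages f y * g y)
    ≡⟨ sum-cong-≗ (λ y → scale-indicator (preimages f y) (suc j)) ⟩
  sum (λ y → suc j * g y)
    ≡⟨ *-distribˡ-sum (suc j) g ⟨
  suc j * sum g
    ≡⟨ cong (suc j *_) (sum-cong-≗ (λ y → cong (λ μ → ⟦ μ ≡ᵇ suc j ⟧) (preimages≡multiplicity f y))) ⟩
  suc j * forbiddenExactly (suc j) (tabulate f) allAvailable ∎
  where
  g : Fin n → ℕ
  g y = ⟦ preimages f y ≡ᵇ suc j ⟧
  image-indicator : ∀ i → ⟦ imageMult f i ≡ᵇ suc j ⟧ ≡ maybe′ g 0 (f i)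
  image-indicator i with f i
  ... | nothing = refl
  ... | just y  = refl

hasParams⇒shape : ∀ {n} (f : PFun n) {A B C q} → HasParams f A B C → A ≡ q * 2 →
  Shape (tabulate f) allAvailable n n B q
hasParams⇒shape {n} f {A} {q = q} (partial2Max , A≡ , B≡ , _) A≡q*2 = record
  { atMostTwice = λ z _ → subst (_≤ 2) (preimages≡multiplicity f z) (partial2Max z)
  ; positions   = length-tabulate f
  ; available   = size-allAvailable n
  ; once        = trans (sym (trans (imageMult-count f 0) (+-identityʳ _))) B≡
  ; twice       = *-cancelʳ-≡ twice q 2 (trans (*-comm twice 2) (trans 2*twice≡A A≡q*2))
  }
  where
  twice : ℕ
  twice = forbiddenExactly 2 (tabulate f) allAvailable
  2*twice≡A : 2 * twice ≡ A
  2*twice≡A = trans (sym (imageMult-count f 1)) A≡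

arrangements-recurrence : ∀ {n n₁ n₂} {cs : Constraints n} {cs₁ : Constraints n₁} {cs₂ : Constraints n₂}
  {av av₁ av₂} {k m p₁ p₂} →
  Shape cs av k m (suc (suc p₁)) p₂ → Shape cs₁ av₁ k m p₁ (suc p₂) →
  Shape cs₂ av₂ (pred (pred k)) (pred (pred m)) p₁ p₂ →
  arrangements cs av ≡ arrangements cs₁ av₁ + arrangements cs₂ av₂
arrangements-recurrence {cs = cs} {cs₁} {cs₂} {av} {av₁} {av₂} {k} {m} {p₁} {p₂} s s₁ s₂ =
  +-cancelʳ-≡ t _ _ (begin
    arrangements cs av + t                    ≡⟨ deletion-contraction ρ ⟩
    arrangements (relaxed ρ) av               ≡⟨ arrangements-determined p₂ (suc p₁) (relaxed-shape ρ) (relaxed-shape ρ₁) ⟩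
    arrangements (relaxed ρ₁) av₁             ≡⟨ deletion-contraction ρ₁ ⟨
    arrangements cs₁ av₁ + t₁                 ≡⟨ cong (arrangements cs₁ av₁ +_) t₁≡t+u ⟩
    arrangements cs₁ av₁ + (t + u)            ≡⟨ cong (λ x → arrangements cs₁ av₁ + (t + x)) u≡a₂ ⟩
    arrangements cs₁ av₁ + (t + arrangements cs₂ av₂)
                                              ≡⟨ cong (arrangements cs₁ av₁ +_) (+-comm t _) ⟩
    arrangements cs₁ av₁ + (arrangements cs₂ av₂ + t)
                                              ≡⟨ +-assoc (arrangements cs₁ av₁) _ t ⟨
    arrangements cs₁ av₁ + arrangements cs₂ av₂ + t   ∎)
  where
  open Reduction
  ρ : Reduction cs av k m (suc p₁) p₂ (suc p₁) p₂
  ρ = reduce-single s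
  ρ₁ : Reduction cs₁ av₁ k m (suc p₁) p₂ p₁ p₂
  ρ₁ = reduce-double s₁
  τ : Reduction (contracted ρ) (contractedAvail ρ) (pred k) (pred m) p₁ p₂ p₁ p₂
  τ = reduce-single (contracted-shape ρ)
  t t₁ u : ℕ
  t  = arrangements (contracted ρ) (contractedAvail ρ)
  t₁ = arrangements (contracted ρ₁) (contractedAvail ρ₁)
  u  = arrangements (contracted τ) (contractedAvail τ)
  t₁≡t+u : t₁ ≡ t + u
  t₁≡t+u = trans (arrangements-determined p₂ p₁ (contracted-shape ρ₁) (relaxed-shape τ))
                 (sym (deletion-contraction τ))
  u≡a₂ : u ≡ arrangements cs₂ av₂
  u≡a₂ = arrangements-determined p₂ p₁ (contracted-shape τ) s₂

mainTheorem4 : (A B C : ℕ) → 2 ∣ A → 2 ≤ B →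
    (f : PFun (A + B + C)) → HasParams f A B C →
    (f₁ : PFun ((A + 2) + (B ∸ 2) + C)) → HasParams f₁ (A + 2) (B ∸ 2) C →
    (f₂ : PFun (A + (B ∸ 2) + C)) → HasParams f₂ A (B ∸ 2) C →
    numDerangements f ≡ numDerangements f₁ + numDerangements f₂
mainTheorem4 A (suc zero)    C _ (s≤s ())
mainTheorem4 A (suc (suc b)) C (divides q A≡q*2) _ f hf f₁ hf₁ f₂ hf₂ = begin
  numDerangements f
    ≡⟨ numDerangements≡arrangements f ⟩
  arrangements (tabulate f) allAvailable
    ≡⟨ arrangements-recurrence (hasParams⇒shape f hf A≡q*2)
         (subst (λ k → Shape (tabulate f₁) allAvailable k k b (suc q)) n₁≡n
                (hasParams⇒shape f₁ hf₁ A+2≡[1+q]*2))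
         (subst (λ k → Shape (tabulate f₂) allAvailable k k b q) n₂≡n-2 (hasParams⇒shape f₂ hf₂ A≡q*2)) ⟩
  arrangements (tabulate f₁) allAvailable + arrangements (tabulate f₂) allAvailable
    ≡⟨ cong₂ _+_ (numDerangements≡arrangements f₁) (numDerangements≡arrangements f₂) ⟨
  numDerangements f₁ + numDerangements f₂ ∎
  where
  A+2≡[1+q]*2 : A + 2 ≡ suc q * 2
  A+2≡[1+q]*2 = trans (cong (_+ 2) A≡q*2) (+-comm (q * 2) 2)
  n₁≡n : A + 2 + b + C ≡ A + suc (suc b) + C
  n₁≡n = cong (_+ C) (+-assoc A 2 b)
  n₂≡n-2 : A + b + C ≡ pred (pred (A + suc (suc b) + C))
  n₂≡n-2 = cong (pred ∘ pred ∘ (_+ C)) (sym (trans (+-suc A (suc b)) (cong suc (+-suc A b))))
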